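{- Let $G$ be a nice bipartite graph. Then for every integer $t\geq 3$, $G$ admits an improper twin $t$-edge coloring.
   Context: A graph is nice if it has no connected component isomorphic to $K_2$ (a component with exactly two vertices). For an integer $k\geq 2$, an improper twin $k$-edge coloring of $G$ is a map $s:E(G)\to\mathbb{Z}_k$ (adjacent edges may receive equal colors) such that the map $c_s:V(G)\to\mathbb{Z}_k$, $c_s(v)=\sum_{e\in E_v}s(e)$ computed in $\mathbb{Z}_k$ (with $E_v$ the set of edges incident to $v$, and the empty sum equal to $0$), is a proper vertex coloring of $G$ (adjacent vertices get different values). -}

module Defs where

open import Data.Nat using (ℕ; zero; suc; _+_; _%_; NonZero)
open import Data.Fin using (Fin; toℕ; _≟_)
open import Data.Bool using (Bool)
open import Data.List using (List; map; allFin)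
open import Data.Nat.ListAction using (sum)
open import Data.Product using (Σ; ∃; _×_; _,_; proj₁; proj₂)
open import Data.Sum using (_⊎_)
open import Relation.Nullary using (¬_; does)
open import Relation.Binary.PropositionalEquality using (_≡_; _≢_)
open import Data.Bool using (true; false; if_then_else_; _∨_)

record Graph : Set where
  field
    n    : ℕ
    m    : ℕ
    ends : Fin m → Fin n × Fin n
    loopless : ∀ e → proj₁ (ends e) ≢ proj₂ (ends e)
    simple   : ∀ e f →
      ((proj₁ (ends e) ≡ proj₁ (ends f)) × (proj₂ (ends e) ≡ proj₂ (ends f)))
      ⊎ ((proj₁ (ends e) ≡ proj₂ (ends f)) × (proj₂ (ends e) ≡ proj₁ (ends f)))
      → e ≡ f

open Graph public

Vertex : Graph → Set
Vertex G = Fin (n G)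

Edge : Graph → Set
Edge G = Fin (m G)

Adj : (G : Graph) → Vertex G → Vertex G → Set
Adj G u v = Σ (Edge G) λ e →
  ((proj₁ (ends G e) ≡ u) × (proj₂ (ends G e) ≡ v))
  ⊎ ((proj₁ (ends G e) ≡ v) × (proj₂ (ends G e) ≡ u))

data Reach (G : Graph) : Vertex G → Vertex G → Set where
  here : ∀ {u} → Reach G u u
  step : ∀ {u v w} → Adj G u v → Reach G v w → Reach G u w

HasK2Component : Graph → Set
HasK2Component G = Σ (Vertex G) λ u → Σ (Vertex G) λ v →
  (u ≢ v) × Reach G u v × (∀ w → Reach G u w → (w ≡ u) ⊎ (w ≡ v))

Nice : Graph → Set
Nice G = ¬ HasK2Component G

Bipartite : Graph → Set
Bipartite G = Σ (Vertex G → Bool) λ side →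
  ∀ e → side (proj₁ (ends G e)) ≢ side (proj₂ (ends G e))

incident : (G : Graph) → Edge G → Vertex G → Bool
incident G e v = does (proj₁ (ends G e) ≟ v) ∨ does (proj₂ (ends G e) ≟ v)

inducedColour : (G : Graph) (k : ℕ) .{{_ : NonZero k}} →
  (Edge G → Fin k) → Vertex G → ℕ
inducedColour G k s v =
  sum (map (λ e → if incident G e v then toℕ (s e) else 0) (allFin (m G))) % k

IsImproperTwinColouring : (G : Graph) (k : ℕ) .{{_ : NonZero k}} →
  (Edge G → Fin k) → Set
IsImproperTwinColouring G k s =
  ∀ u v → Adj G u v → inducedColour G k s u ≢ inducedColour G k s v

HasImproperTwinColouring : (G : Graph) (k : ℕ) .{{_ : NonZero k}} → Set
HasImproperTwinColouring G k = Σ (Edge G → Fin k) (IsImproperTwinColouring G k)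

module Submission where

-- Colour every vertex by its side of the bipartition, 1 or 0 (τ below).  Pushing a weight x along a
-- walk from v to w, alternately +x and −x on its edges, changes the vertex sums only at v and w.  Call
-- v a root if no vertex of higher index lies within distance 5 of v; processing the other vertices in
-- increasing order, each receives the sum τ v by a push towards such a later vertex.  Roots are then
-- more than 5 apart, so each root r can be repaired independently, within distance 2 of r, if its sum
-- equals the colour c of its neighbours.  If some neighbour u of r has a further neighbour w, weights
-- on r–u–w move r to 2 and w to −1; if r has two neighbours and all are leaves, weight 1 on two of its
-- edges moves r to c + 2 and those leaves to c + 1 (this is where t ≥ 3 is used).  Otherwise r has a
-- single neighbour, itself a leaf, and the pair would be a K₂ component.

open import Defs
open import Data.Nat using (ℕ; _≤_; _<_; s≤s; z≤n; >-nonZero)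
open import Data.Nat.Properties using (<-≤-trans)

open import Algebra.Bundles using (Monoid; CommutativeMonoid)
open import Algebra.Structures using (IsCommutativeMonoid)
open import Data.Bool using (Bool; true; false; if_then_else_; _∨_)
open import Data.Bool.Properties using (¬-not)
open import Data.Fin as Fin using (Fin; zero; suc; toℕ; fromℕ<)
open import Data.Fin.Properties using (any?; toℕ<n; toℕ-fromℕ<; toℕ-injective)
open import Data.List using (List; []; _∷_; tabulate)
open import Data.List.Membership.Propositional using (_∈_; _∉_)
open import Data.List.Properties using (map-tabulate)
open import Data.List.Relation.Unary.Any using (here; there)
open import Data.Nat using (zero; suc; _+_; _*_; _∸_; _%_; _/_; _≟_; _<?_; s≤s⁻¹; NonZero)
open import Data.Nat.DivMod
  using (%-distribˡ-+; m%n%n≡m%n; m%n≤n; m%n<n; [m+n]%n≡m%n; m≡m%n+[m/n]*n)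
open import Data.Nat.Divisibility using (_∣_; divides; ∣m+n∣m⇒∣n; ∣⇒≤; n∣m*n)
open import Data.Nat.ListAction using () renaming (sum to listSum)
open import Data.Nat.Properties
  using (+-assoc; +-comm; +-identityˡ; +-identityʳ; +-cancelˡ-≡; m+[n∸m]≡n; m∸n≤m; m<n⇒0<n∸m;
         ≤-refl; ≤-trans; <⇒≤; <⇒≱; ≤-<-trans; <-irrefl; <-cmp; m≤m+n; m≤n+m; m<1+n⇒m<n∨m≡n)
open import Data.Product using (Σ; _×_; _,_; proj₁; proj₂)
open import Data.Sum using (_⊎_; inj₁; inj₂)
open import Data.Vec.Functional using (Vector; head; tail)
open import Function using (id)
open import Level using (0ℓ)
open import Relation.Binary.Definitions using (tri<; tri≈; tri>)
open import Relation.Binary.PropositionalEquality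
  using (_≡_; _≢_; refl; sym; trans; cong; cong₂; subst; ≢-sym; module ≡-Reasoning)
open import Relation.Binary.Structures using (IsEquivalence)
open import Relation.Nullary using (¬_; Dec; yes; no; does; contradiction)
open import Relation.Nullary.Decidable using (_×-dec_; _⊎-dec_; ¬?; map′; dec-true; dec-false)

module MonoidSum {a ℓ} (M : Monoid a ℓ) where
  open Monoid M using (Carrier; _≈_; _∙_; ε; ∙-congˡ; ∙-congʳ; identityˡ; identityʳ; setoid)
  open import Algebra.Properties.Monoid.Sum M using (sum; sum-cong-≋; sum-replicate-zero)
  open import Relation.Binary.Reasoning.Setoid setoid

  sum-zero : ∀ {n} (f : Vector Carrier n) → (∀ i → f i ≈ ε) → sum f ≈ ε
  sum-zero {n} f f≈ε = begin
    sum f                    ≈⟨ sum-cong-≋ f≈ε ⟩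
    sum (λ (_ : Fin n) → ε)  ≈⟨ sum-replicate-zero n ⟩
    ε                        ∎

  sum-select : ∀ {n} (f : Vector Carrier n) i → (∀ j → j ≢ i → f j ≈ ε) → sum f ≈ f i
  sum-select f zero rest = begin
    head f ∙ sum (tail f)  ≈⟨ ∙-congˡ (sum-zero (tail f) λ j → rest (suc j) λ ()) ⟩
    head f ∙ ε             ≈⟨ identityʳ (head f) ⟩
    head f                 ∎
  sum-select f (suc i) rest = begin
    head f ∙ sum (tail f)  ≈⟨ ∙-congʳ (rest zero λ ()) ⟩
    ε ∙ sum (tail f)       ≈⟨ identityˡ (sum (tail f)) ⟩
    sum (tail f)           ≈⟨ sum-select (tail f) i (λ j j≢i → rest (suc j) λ { refl → j≢i refl }) ⟩
    f (suc i)              ∎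

module Modulo (t : ℕ) .{{_ : NonZero t}} where

  infix 4 _≈_ _≉_

  -- A record rather than a synonym, so that a and b can be inferred from a proof.
  record _≈_ (a b : ℕ) : Set where
    constructor %≡⇒≈
    field ≈⇒%≡ : a % t ≡ b % t
  open _≈_ public

  _≉_ : ℕ → ℕ → Set
  a ≉ b = ¬ a ≈ b

  ≡⇒≈ : ∀ {a b} → a ≡ b → a ≈ b
  ≡⇒≈ refl = %≡⇒≈ refl

  ≈-isEquivalence : IsEquivalence _≈_
  ≈-isEquivalence = record
    { refl = %≡⇒≈ refl
    ; sym = λ (%≡⇒≈ p) → %≡⇒≈ (sym p)
    ; trans = λ (%≡⇒≈ p) (%≡⇒≈ q) → %≡⇒≈ (trans p q)
    }

  +-cong : ∀ {a a' b b'} → a ≈ a' → b ≈ b' → a + b ≈ a' + b'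
  +-cong {a} {a'} {b} {b'} (%≡⇒≈ p) (%≡⇒≈ q) = %≡⇒≈ (begin
    (a + b) % t              ≡⟨ %-distribˡ-+ a b t ⟩
    (a % t + b % t) % t      ≡⟨ cong₂ (λ x y → (x + y) % t) p q ⟩
    (a' % t + b' % t) % t    ≡⟨ %-distribˡ-+ a' b' t ⟨
    (a' + b') % t            ∎)
    where open ≡-Reasoning

  +-isCommutativeMonoid : IsCommutativeMonoid _≈_ _+_ 0
  +-isCommutativeMonoid = record
    { isMonoid = record
      { isSemigroup = record
        { isMagma = record { isEquivalence = ≈-isEquivalence ; ∙-cong = +-cong }
        ; assoc = λ a b c → ≡⇒≈ (+-assoc a b c)
        }
      ; identity = (λ a → ≡⇒≈ (+-identityˡ a)) , (λ a → ≡⇒≈ (+-identityʳ a))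
      }
    ; comm = λ a b → ≡⇒≈ (+-comm a b)
    }

  +-commutativeMonoid : CommutativeMonoid 0ℓ 0ℓ
  +-commutativeMonoid = record { isCommutativeMonoid = +-isCommutativeMonoid }

  open CommutativeMonoid +-commutativeMonoid public
    using (setoid) renaming (refl to ≈-refl; sym to ≈-sym; trans to ≈-trans)
  open import Algebra.Properties.CommutativeMonoid.Sum +-commutativeMonoid public
    using (sum; ∑-distrib-+; ∑-comm; sum-cong-≋)
  open MonoidSum (CommutativeMonoid.monoid +-commutativeMonoid) public
  open import Algebra.Properties.CommutativeSemigroup
    (CommutativeMonoid.commutativeSemigroup +-commutativeMonoid) public using (x∙yz≈y∙xz)

  neg : ℕ → ℕ
  neg x = t ∸ x % t

  t≈0 : t ≈ 0
  t≈0 = %≡⇒≈ ([m+n]%n≡m%n 0 t)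

  +-neg : ∀ x → x + neg x ≈ 0
  +-neg x = begin
    x + neg x          ≈⟨ +-cong (%≡⇒≈ (sym (m%n%n≡m%n x t))) ≈-refl ⟩
    x % t + neg x      ≡⟨ m+[n∸m]≡n (m%n≤n x t) ⟩
    t                  ≈⟨ t≈0 ⟩
    0                  ∎
    where open import Relation.Binary.Reasoning.Setoid setoid

  c+d≈c⇒t∣d : ∀ c d → c + d ≈ c → t ∣ d
  c+d≈c⇒t∣d c d (%≡⇒≈ c+d≡c) = ∣m+n∣m⇒∣n (divides ((c + d) / t) eq) (n∣m*n (c / t))
    where
      eq : c / t * t + d ≡ (c + d) / t * t
      eq = +-cancelˡ-≡ (c % t) _ _ (begin
        c % t + (c / t * t + d)   ≡⟨ +-assoc (c % t) _ d ⟨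
        c % t + c / t * t + d     ≡⟨ cong (_+ d) (m≡m%n+[m/n]*n c t) ⟨
        c + d                     ≡⟨ m≡m%n+[m/n]*n (c + d) t ⟩
        (c + d) % t + (c + d) / t * t ≡⟨ cong (_+ (c + d) / t * t) c+d≡c ⟩
        c % t + (c + d) / t * t   ∎)
        where open ≡-Reasoning

  c+d≉c : ∀ c {d} → 0 < d → d < t → c + d ≉ c
  c+d≉c c {d@(suc _)} _ d<t c+d≈c = <⇒≱ d<t (∣⇒≤ (c+d≈c⇒t∣d c d c+d≈c))

  ≉-sym : ∀ {a b} → a ≉ b → b ≉ a
  ≉-sym a≉b b≈a = a≉b (≈-sym b≈a)

  <⇒≉ : ∀ {a b} → a < b → b < t → a ≉ b
  <⇒≉ {a} {b} a<b b<t a≈b = c+d≉c a (m<n⇒0<n∸m a<b) (≤-<-trans (m∸n≤m b a) b<t)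
    (≈-trans (≡⇒≈ (m+[n∸m]≡n (<⇒≤ a<b))) (≈-sym a≈b))

  ≉-respˡ : ∀ {a b c} → a ≈ b → b ≉ c → a ≉ c
  ≉-respˡ a≈b b≉c a≈c = b≉c (≈-trans (≈-sym a≈b) a≈c)

  ≉-respʳ : ∀ {a b c} → b ≈ c → a ≉ b → a ≉ c
  ≉-respʳ b≈c a≉b a≈c = a≉b (≈-trans a≈c (≈-sym b≈c))

  _≈?_ : ∀ a b → Dec (a ≈ b)
  a ≈? b = map′ %≡⇒≈ ≈⇒%≡ (a % t ≟ b % t)

module Walks (G : Graph) where

  private
    V = Vertex G

  adj-sym : ∀ {u v} → Adj G u v → Adj G v u
  adj-sym (e , inj₁ ends≡) = e , inj₂ ends≡
  adj-sym (e , inj₂ ends≡) = e , inj₁ ends≡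

  adj⇒≢ : ∀ {u v} → Adj G u v → u ≢ v
  adj⇒≢ (e , inj₁ (refl , refl)) = loopless G e
  adj⇒≢ (e , inj₂ (refl , refl)) = ≢-sym (loopless G e)

  adj? : ∀ u v → Dec (Adj G u v)
  adj? u v = any? λ e → ((proj₁ (ends G e) Fin.≟ u) ×-dec (proj₂ (ends G e) Fin.≟ v))
                     ⊎-dec ((proj₁ (ends G e) Fin.≟ v) ×-dec (proj₂ (ends G e) Fin.≟ u))

  Walk≤ : ℕ → V → V → Set
  Walk≤ zero    u v = u ≡ v
  Walk≤ (suc j) u v = u ≡ v ⊎ Σ V λ y → Adj G u y × Walk≤ j y v

  walk? : ∀ j u v → Dec (Walk≤ j u v)
  walk? zero    u v = u Fin.≟ v
  walk? (suc j) u v = (u Fin.≟ v) ⊎-dec any? λ y → adj? u y ×-dec walk? j y v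

  walk-refl : ∀ j u → Walk≤ j u u
  walk-refl zero    u = refl
  walk-refl (suc j) u = inj₁ refl

  walk-adj : ∀ {u v} → Adj G u v → Walk≤ 1 u v
  walk-adj a = inj₂ (_ , a , refl)

  walk-mono : ∀ {i j u v} → i ≤ j → Walk≤ i u v → Walk≤ j u v
  walk-mono {j = j} z≤n refl = walk-refl j _
  walk-mono (s≤s i≤j) (inj₁ u≡v) = inj₁ u≡v
  walk-mono (s≤s i≤j) (inj₂ (y , a , p)) = inj₂ (y , a , walk-mono i≤j p)

  walk-++ : ∀ {i j u v w} → Walk≤ i u v → Walk≤ j v w → Walk≤ (i + j) u w
  walk-++ {zero}  refl q = q
  walk-++ {suc i} {j} (inj₁ refl) q = walk-mono (m≤n+m j (suc i)) q
  walk-++ {suc i} (inj₂ (y , a , p)) q = inj₂ (y , a , walk-++ p q)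

  walk-snoc : ∀ {j u v w} → Walk≤ j u v → Adj G v w → Walk≤ (suc j) u w
  walk-snoc {zero} refl a = walk-adj a
  walk-snoc {suc j} (inj₁ refl) a = walk-mono (s≤s z≤n) (walk-adj a)
  walk-snoc {suc j} (inj₂ (y , b , p)) a = inj₂ (y , b , walk-snoc p a)

  walk-sym : ∀ {j u v} → Walk≤ j u v → Walk≤ j v u
  walk-sym {zero}  refl = refl
  walk-sym {suc j} (inj₁ u≡v) = inj₁ (sym u≡v)
  walk-sym {suc j} (inj₂ (y , a , p)) = walk-snoc (walk-sym p) (adj-sym a)

  Later : ℕ → V → Set
  Later j v = Σ V λ w → toℕ v < toℕ w × Walk≤ j v w

  later? : ∀ j v → Dec (Later j v)
  later? j v = any? λ w → (toℕ v <? toℕ w) ×-dec walk? j v w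

  Root : ℕ → V → Set
  Root j v = ¬ Later j v

  root-unique : ∀ {j r r'} → Root j r → Root j r' → Walk≤ j r r' → r ≡ r'
  root-unique {r = r} {r'} root root' p with <-cmp (toℕ r) (toℕ r')
  ... | tri< r<r' _ _ = contradiction (r' , r<r' , p) root
  ... | tri≈ _ r≡r' _ = toℕ-injective r≡r'
  ... | tri> _ _ r'<r = contradiction (r , r'<r , walk-sym p) root'

  Path₂ : V → Set
  Path₂ r = Σ V λ u → Σ V λ w → Adj G r u × Adj G u w × w ≢ r

  TwoNeighbours : V → Set
  TwoNeighbours r = Σ V λ u₁ → Σ V λ u₂ → Adj G r u₁ × Adj G r u₂ × u₁ ≢ u₂

  path₂? : ∀ r → Dec (Path₂ r)
  path₂? r = any? λ u → any? λ w → adj? r u ×-dec adj? u w ×-dec ¬? (w Fin.≟ r)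

  twoNeighbours? : ∀ r → Dec (TwoNeighbours r)
  twoNeighbours? r = any? λ u₁ → any? λ u₂ → adj? r u₁ ×-dec adj? r u₂ ×-dec ¬? (u₁ Fin.≟ u₂)

  isolated-edge⇒K₂ : ∀ {r u} → Adj G r u → ¬ Path₂ r → ¬ TwoNeighbours r → HasK2Component G
  isolated-edge⇒K₂ {r} {u} a ¬path ¬two = r , u , adj⇒≢ a , step a here , λ _ → closed (inj₁ refl)
    where
      closed : ∀ {x y} → x ≡ r ⊎ x ≡ u → Reach G x y → y ≡ r ⊎ y ≡ u
      closed x∈ru here = x∈ru
      closed (inj₁ refl) (step {v = y} b rest) with y Fin.≟ u
      ... | yes y≡u = closed (inj₂ y≡u) rest
      ... | no  y≢u = contradiction (u , y , a , b , ≢-sym y≢u) ¬two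
      closed (inj₂ refl) (step {v = y} b rest) with y Fin.≟ r
      ... | yes y≡r = closed (inj₁ y≡r) rest
      ... | no  y≢r = contradiction (u , y , a , b , y≢r) ¬path

module Weightings (G : Graph) (t : ℕ) .{{_ : NonZero t}} where
  open Modulo t
  open Walks G
  open import Relation.Binary.Reasoning.Setoid setoid

  private
    V = Vertex G
    E = Edge G

  if-+ : ∀ b x y → (if b then x + y else 0) ≡ (if b then x else 0) + (if b then y else 0)
  if-+ true  x y = refl
  if-+ false x y = refl

  if-cong : ∀ b {x y} → x ≈ y → (if b then x else 0) ≈ (if b then y else 0)
  if-cong true  x≈y = x≈y
  if-cong false x≈y = ≈-refl

  if-0 : ∀ b → (if b then 0 else 0) ≡ 0
  if-0 true  = refl
  if-0 false = refl

  if-sum : ∀ b {n} (f : Fin n → ℕ) → (if b then sum f else 0) ≈ sum (λ i → if b then f i else 0)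
  if-sum true  f = ≈-refl
  if-sum false {n} f = ≈-sym (sum-zero {n} _ λ _ → ≈-refl)

  if-if : ∀ b c x → (if b then (if c then x else 0) else 0) ≡ (if c then (if b then x else 0) else 0)
  if-if true  c x = refl
  if-if false true  x = refl
  if-if false false x = refl

  -- Opaque so that unification treats δ i x j as rigid.
  opaque
    δ : ∀ {n} → Fin n → ℕ → Fin n → ℕ
    δ i x j = if does (i Fin.≟ j) then x else 0

    δ-≢ : ∀ {n} {i j : Fin n} x → i ≢ j → δ i x j ≡ 0
    δ-≢ {i = i} {j} x i≢j rewrite dec-false (i Fin.≟ j) i≢j = refl

    δ-diag : ∀ {n} (i : Fin n) x → δ i x i ≡ x
    δ-diag i x rewrite dec-true (i Fin.≟ i) refl = refl

    δ-0 : ∀ {n} (i j : Fin n) → δ i 0 j ≡ 0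
    δ-0 i j = if-0 (does (i Fin.≟ j))

    δ-+ : ∀ {n} (i j : Fin n) x y → δ i x j + δ i y j ≡ δ i (x + y) j
    δ-+ i j x y = sym (if-+ (does (i Fin.≟ j)) x y)

    δ-cong : ∀ {n} (i j : Fin n) {x y} → x ≈ y → δ i x j ≈ δ i y j
    δ-cong i j = if-cong (does (i Fin.≟ j))

    if-δ : ∀ b {n} (i j : Fin n) x → (if b then δ i x j else 0) ≡ δ i (if b then x else 0) j
    if-δ b i j = if-if b (does (i Fin.≟ j))

    if-incident : ∀ {a b : Vertex G} → a ≢ b → ∀ x z →
      (if does (a Fin.≟ z) ∨ does (b Fin.≟ z) then x else 0) ≡ δ a x z + δ b x z
    if-incident {a} {b} a≢b x z with a Fin.≟ z | b Fin.≟ z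
    ... | yes refl | yes refl = contradiction refl a≢b
    ... | yes _    | no _     = sym (+-identityʳ x)
    ... | no _     | yes _    = refl
    ... | no _     | no _     = refl

  Weighting : Set
  Weighting = E → ℕ

  sumAt : Weighting → V → ℕ
  sumAt W v = sum λ e → if incident G e v then W e else 0

  sumAt-cong : ∀ {W W'} → (∀ e → W e ≈ W' e) → ∀ v → sumAt W v ≈ sumAt W' v
  sumAt-cong W≈W' v = sum-cong-≋ λ e → if-cong (incident G e v) (W≈W' e)

  sumAt-+ : ∀ W W' v → sumAt (λ e → W e + W' e) v ≈ sumAt W v + sumAt W' v
  sumAt-+ W W' v = ≈-trans (sum-cong-≋ λ e → ≡⇒≈ (if-+ (incident G e v) (W e) (W' e)))
                           (∑-distrib-+ {m G} _ _)

  sumAt-0 : ∀ v → sumAt (λ _ → 0) v ≈ 0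
  sumAt-0 v = sum-zero {m G} _ λ e → ≡⇒≈ (if-0 (incident G e v))

  sumAt-sum : ∀ {n} (F : Fin n → Weighting) v →
    sumAt (λ e → sum λ i → F i e) v ≈ sum λ i → sumAt (F i) v
  sumAt-sum {n} F v = ≈-trans (sum-cong-≋ λ e → if-sum (incident G e v) (λ i → F i e))
                              (∑-comm {m G} {n} λ e i → if incident G e v then F i e else 0)

  sumAt-δ : ∀ e x v → sumAt (δ e x) v ≈ (if incident G e v then x else 0)
  sumAt-δ e x v = begin
    sumAt (δ e x) v
      ≈⟨ sum-cong-≋ (λ e′ → ≡⇒≈ (if-δ (incident G e′ v) e e′ x)) ⟩
    sum (λ e′ → δ e (if incident G e′ v then x else 0) e′)
      ≈⟨ sum-select _ e (λ e′ e′≢e → ≡⇒≈ (δ-≢ _ (≢-sym e′≢e))) ⟩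
    δ e (if incident G e v then x else 0) e                 ≡⟨ δ-diag e _ ⟩
    (if incident G e v then x else 0)                       ∎

  sumAt-adj : ∀ {u v} (a : Adj G u v) x z → sumAt (δ (proj₁ a) x) z ≈ δ u x z + δ v x z
  sumAt-adj (e , inj₁ (refl , refl)) x z =
    ≈-trans (sumAt-δ e x z) (≡⇒≈ (if-incident (loopless G e) x z))
  sumAt-adj {u} {v} (e , inj₂ (refl , refl)) x z =
    ≈-trans (sumAt-δ e x z) (≡⇒≈ (trans (if-incident (loopless G e) x z) (+-comm (δ v x z) (δ u x z))))

  transfer : ∀ {j u v} → Walk≤ j u v → ℕ → Weighting
  transfer {zero}  _                  x e = 0
  transfer {suc j} (inj₁ _)           x e = 0
  transfer {suc j} (inj₂ (y , a , p)) x e = δ (proj₁ a) x e + transfer p (neg x) e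

  sumAt-transfer : ∀ {j u v} (p : Walk≤ j u v) x z → z ≢ v → sumAt (transfer p x) z ≈ δ u x z
  sumAt-transfer {zero}  refl        x z z≢v = ≈-trans (sumAt-0 z) (≡⇒≈ (sym (δ-≢ x (≢-sym z≢v))))
  sumAt-transfer {suc j} (inj₁ refl) x z z≢v = ≈-trans (sumAt-0 z) (≡⇒≈ (sym (δ-≢ x (≢-sym z≢v))))
  sumAt-transfer {suc j} {u} (inj₂ (y , a , p)) x z z≢v = begin
    sumAt (transfer (inj₂ (y , a , p)) x) z                ≈⟨ sumAt-+ (δ (proj₁ a) x) (transfer p (neg x)) z ⟩
    sumAt (δ (proj₁ a) x) z + sumAt (transfer p (neg x)) z ≈⟨ +-cong (sumAt-adj a x z) (sumAt-transfer p (neg x) z z≢v) ⟩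
    (δ u x z + δ y x z) + δ y (neg x) z                     ≡⟨ +-assoc (δ u x z) _ _ ⟩
    δ u x z + (δ y x z + δ y (neg x) z)                     ≡⟨ cong (δ u x z +_) (δ-+ y z x (neg x)) ⟩
    δ u x z + δ y (x + neg x) z                             ≈⟨ +-cong ≈-refl (δ-cong y z (+-neg x)) ⟩
    δ u x z + δ y 0 z                                       ≡⟨ cong (δ u x z +_) (δ-0 y z) ⟩
    δ u x z + 0                                             ≡⟨ +-identityʳ _ ⟩
    δ u x z                                                 ∎

  below-or-last : ∀ {i} (i<n : i < n G) {v : V} → toℕ v < suc i → toℕ v < i ⊎ v ≡ fromℕ< i<n
  below-or-last i<n v≤i with m<1+n⇒m<n∨m≡n v≤i
  ... | inj₁ v<i = inj₁ v<i
  ... | inj₂ v≡i = inj₂ (toℕ-injective (trans v≡i (sym (toℕ-fromℕ< i<n))))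

  settle-prefix : ∀ j (f : V → ℕ) i → i ≤ n G →
    Σ Weighting λ W → ∀ v → toℕ v < i → Later j v → sumAt W v ≈ f v
  settle-prefix j f zero    _   = (λ _ → 0) , λ _ ()
  settle-prefix j f (suc i) i<n with settle-prefix j f i (<⇒≤ i<n) | later? j (fromℕ< i<n)
  ... | W , settled | no ¬later = W , settled′
    where
      settled′ : ∀ v → toℕ v < suc i → Later j v → sumAt W v ≈ f v
      settled′ v v≤i later with below-or-last i<n v≤i
      ... | inj₁ v<i  = settled v v<i later
      ... | inj₂ refl = contradiction later ¬later
  ... | W , settled | yes (w , v₀<w , p) = (λ e → W e + transfer p x e) , settled′
    where
      v₀ = fromℕ< i<n
      x = f v₀ + neg (sumAt W v₀)
      settled′ : ∀ v → toℕ v < suc i → Later j v → sumAt (λ e → W e + transfer p x e) v ≈ f v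
      settled′ v v≤i later = begin
        sumAt (λ e → W e + transfer p x e) v    ≈⟨ sumAt-+ W (transfer p x) v ⟩
        sumAt W v + sumAt (transfer p x) v      ≈⟨ +-cong ≈-refl (sumAt-transfer p x v v≢w) ⟩
        sumAt W v + δ v₀ x v                    ≈⟨ fixed (below-or-last i<n v≤i) ⟩
        f v                                     ∎
        where
          v≢w : v ≢ w
          v≢w refl = <-irrefl refl (≤-<-trans (s≤s⁻¹ v≤i) (subst (_< toℕ w) (toℕ-fromℕ< i<n) v₀<w))
          fixed : toℕ v < i ⊎ v ≡ v₀ → sumAt W v + δ v₀ x v ≈ f v
          fixed (inj₁ v<i) = begin
            sumAt W v + δ v₀ x v   ≡⟨ cong (sumAt W v +_) (δ-≢ x λ { refl → <-irrefl (toℕ-fromℕ< i<n) v<i }) ⟩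
            sumAt W v + 0          ≡⟨ +-identityʳ _ ⟩
            sumAt W v              ≈⟨ settled v v<i later ⟩
            f v                    ∎
          fixed (inj₂ refl) = begin
            sumAt W v₀ + δ v₀ x v₀                     ≡⟨ cong (sumAt W v₀ +_) (δ-diag v₀ x) ⟩
            sumAt W v₀ + (f v₀ + neg (sumAt W v₀))    ≈⟨ x∙yz≈y∙xz (sumAt W v₀) (f v₀) _ ⟩
            f v₀ + (sumAt W v₀ + neg (sumAt W v₀))    ≈⟨ +-cong ≈-refl (+-neg (sumAt W v₀)) ⟩
            f v₀ + 0                                   ≡⟨ +-identityʳ _ ⟩
            f v₀                                       ∎

  settle : ∀ j (f : V → ℕ) → Σ Weighting λ W → ∀ v → Later j v → sumAt W v ≈ f v
  settle j f with settle-prefix j f (n G) ≤-refl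
  ... | W , settled = W , λ v → settled v (toℕ<n v)

  inducedColour≡sumAt : ∀ (s : E → Fin t) v → inducedColour G t s v ≡ sumAt (λ e → toℕ (s e)) v % t
  inducedColour≡sumAt s v = cong (_% t) (trans (cong listSum (map-tabulate id f)) (listSum-tabulate f))
    where
      f : E → ℕ
      f e = if incident G e v then toℕ (s e) else 0
      listSum-tabulate : ∀ {n} (g : Fin n → ℕ) → listSum (tabulate g) ≡ sum g
      listSum-tabulate {zero}  g = refl
      listSum-tabulate {suc n} g = cong (g Fin.zero +_) (listSum-tabulate (λ i → g (Fin.suc i)))

module Construction (G : Graph) (nice : Nice G) (side : Vertex G → Bool)
  (bipartite : ∀ e → side (proj₁ (ends G e)) ≢ side (proj₂ (ends G e))) (k : ℕ) where

  t : ℕ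
  t = 3 + k

  open Modulo t
  open Walks G
  open Weightings G t
  open import Relation.Binary.Reasoning.Setoid setoid
  open import Data.List.Membership.DecPropositional (Fin._≟_ {n G}) using (_∈?_)

  private
    V = Vertex G

  ≤2⇒<t : ∀ {a} → a ≤ 2 → a < t
  ≤2⇒<t a≤2 = ≤-trans (s≤s a≤2) (m≤m+n 3 k)

  adj⇒side≢ : ∀ {p q} → Adj G p q → side p ≢ side q
  adj⇒side≢ (e , inj₁ (refl , refl)) = bipartite e
  adj⇒side≢ (e , inj₂ (refl , refl)) = ≢-sym (bipartite e)

  adj²⇒side≡ : ∀ {p q w} → Adj G p q → Adj G q w → side p ≡ side w
  adj²⇒side≡ pq qw = trans (¬-not (adj⇒side≢ pq)) (sym (¬-not (adj⇒side≢ (adj-sym qw))))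

  -- τ z is the target colour of z, and τ̄ z that of its neighbours.
  τ τ̄ : V → ℕ
  τ z = if side z then 1 else 0
  τ̄ z = if side z then 0 else 1

  τ̄≤1 : ∀ z → τ̄ z ≤ 1
  τ̄≤1 z with side z
  ... | true  = z≤n
  ... | false = s≤s z≤n

  τ≉τ̄ : ∀ z → τ z ≉ τ̄ z
  τ≉τ̄ z with side z
  ... | true  = ≉-sym (<⇒≉ (s≤s z≤n) (≤2⇒<t (s≤s z≤n)))
  ... | false = <⇒≉ (s≤s z≤n) (≤2⇒<t (s≤s z≤n))

  τ-adj : ∀ {p q} → Adj G p q → τ p ≡ τ̄ q
  τ-adj {p} {q} a with side p | side q | adj⇒side≢ a
  ... | true  | true  | ≢ = contradiction refl ≢
  ... | true  | false | _ = refl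
  ... | false | true  | _ = refl
  ... | false | false | ≢ = contradiction refl ≢

  >1⇒≉τ̄ : ∀ z {a} → 2 ≤ a → a < t → a ≉ τ̄ z
  >1⇒≉τ̄ z 2≤a a<t = ≉-sym (<⇒≉ (≤-trans (s≤s (τ̄≤1 z)) 2≤a) a<t)

  adj⇒τ≉ : ∀ {p q} → Adj G p q → τ p ≉ τ q
  adj⇒τ≉ {p} {q} a rewrite τ-adj a = ≉-sym (τ≉τ̄ q)

  W₀ : Weighting
  W₀ = proj₁ (settle 5 τ)

  W₀-settled : ∀ {r z} → Root 5 r → Walk≤ 5 r z → z ≢ r → sumAt W₀ z ≈ τ z
  W₀-settled {r} {z} root rz z≢r with later? 5 z
  ... | yes later = proj₂ (settle 5 τ) z later
  ... | no  root′ = contradiction (sym (root-unique root root′ rz)) z≢r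

  within₂⇒₅ : ∀ {r z} → Walk≤ 2 r z → Walk≤ 5 r z
  within₂⇒₅ = walk-mono (m≤m+n 2 3)

  within₂-adj⇒₅ : ∀ {r p q} → Walk≤ 2 r p → Adj G p q → Walk≤ 5 r q
  within₂-adj⇒₅ rp a = walk-mono (m≤m+n 3 2) (walk-snoc rp a)

  val : Weighting → V → ℕ
  val R z = sumAt W₀ z + sumAt R z

  Repair : V → Weighting → Set
  Repair r R = (∀ z → ¬ Walk≤ 2 r z → sumAt R z ≈ 0)
             × (∀ p q → Adj G p q → Walk≤ 2 r p → val R p ≉ val R q)

  -- S contains the vertices whose colour may differ from τ after the repair R.
  patch : ∀ {r} → Root 5 r → (R : Weighting) (S : List V) → r ∈ S →
    (∀ {z} → z ∈ S → Walk≤ 2 r z) →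
    (∀ z → z ∉ S → sumAt R z ≈ 0) →
    (∀ {p q} → Adj G p q → p ∈ S → q ∉ S → val R p ≉ τ̄ p) →
    (∀ {p q} → Adj G p q → p ∈ S → q ∈ S → val R p ≉ val R q) →
    Repair r R
  patch {r} root R S r∈S S-near outside-zero special-vs-settled special-vs-special =
    (λ z z-far → outside-zero z λ z∈S → z-far (S-near z∈S)) , proper
    where
      val-settled : ∀ {z} → Walk≤ 5 r z → z ∉ S → val R z ≈ τ z
      val-settled {z} rz z∉S = begin
        sumAt W₀ z + sumAt R z  ≈⟨ +-cong (W₀-settled root rz λ { refl → z∉S r∈S }) (outside-zero z z∉S) ⟩
        τ z + 0                 ≡⟨ +-identityʳ (τ z) ⟩
        τ z                     ∎
      proper : ∀ p q → Adj G p q → Walk≤ 2 r p → val R p ≉ val R q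
      proper p q a rp with p ∈? S | q ∈? S
      ... | yes p∈S | yes q∈S = special-vs-special a p∈S q∈S
      ... | yes p∈S | no  q∉S = λ p≈q → special-vs-settled a p∈S q∉S
             (≈-trans p≈q (≈-trans (val-settled (within₂-adj⇒₅ rp a) q∉S) (≡⇒≈ (τ-adj (adj-sym a)))))
      ... | no  p∉S | yes q∈S = λ p≈q → special-vs-settled (adj-sym a) q∈S p∉S
             (≈-trans (≈-sym p≈q) (≈-trans (val-settled (within₂⇒₅ rp) p∉S) (≡⇒≈ (τ-adj a))))
      ... | no  p∉S | no  q∉S = λ p≈q → adj⇒τ≉ a (begin
             τ p      ≈⟨ val-settled (within₂⇒₅ rp) p∉S ⟨
             val R p  ≈⟨ p≈q ⟩
             val R q  ≈⟨ val-settled (within₂-adj⇒₅ rp a) q∉S ⟩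
             τ q      ∎)

  val-0 : ∀ z → val (λ _ → 0) z ≈ sumAt W₀ z
  val-0 z = ≈-trans (+-cong ≈-refl (sumAt-0 z)) (≡⇒≈ (+-identityʳ _))

  no-conflict : ∀ {r} → Root 5 r → (∀ {q} → Adj G r q → sumAt W₀ r ≉ τ̄ r) → Repair r (λ _ → 0)
  no-conflict {r} root fine = patch root (λ _ → 0) (r ∷ []) (here refl)
    (λ { (here refl) → walk-refl 2 r })
    (λ z _ → sumAt-0 z)
    (λ { a (here refl) _ → λ r≈τ̄ → fine a (≈-trans (≈-sym (val-0 r)) r≈τ̄) })
    (λ { a (here refl) (here refl) → contradiction refl (adj⇒≢ a) })

  -- The weights are chosen so that r ends at 2 and w at t − 1 while u is unchanged modulo t.
  raise-along-path₂ : ∀ {r u w} → Root 5 r → sumAt W₀ r ≈ τ̄ r →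
    Adj G r u → Adj G u w → w ≢ r → Σ Weighting (Repair r)
  raise-along-path₂ {r} {u} {w} root conflict ru uw w≢r = R , patch root R (r ∷ w ∷ []) (here refl)
    (λ { (here refl) → walk-refl 2 r ; (there (here refl)) → rw })
    (λ z z∉S → ≈-trans (sumAt-R z) (≡⇒≈ (cong₂ _+_
       (δ-≢ x λ { refl → z∉S (here refl) }) (δ-≢ x′ λ { refl → z∉S (there (here refl)) }))))
    (λ { _ (here refl) _ → ≉-respˡ val-r (>1⇒≉τ̄ r ≤-refl (≤2⇒<t ≤-refl))
       ; _ (there (here refl)) _ → ≉-respˡ val-w (>1⇒≉τ̄ w (s≤s (s≤s z≤n)) ≤-refl) })
    (λ a p∈S q∈S → contradiction (trans (side-S p∈S) (sym (side-S q∈S))) (adj⇒side≢ a))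
    where
      x x′ : ℕ
      x  = 1 + τ r
      x′ = τ̄ r + suc k
      rw : Walk≤ 2 r w
      rw = inj₂ (u , ru , inj₂ (w , uw , refl))
      sw≡sr : side w ≡ side r
      sw≡sr = sym (adj²⇒side≡ ru uw)
      τw≡τr : τ w ≡ τ r
      τw≡τr = cong (λ s → if s then 1 else 0) sw≡sr
      side-S : ∀ {z} → z ∈ r ∷ w ∷ [] → side z ≡ side r
      side-S (here refl)         = refl
      side-S (there (here refl)) = sw≡sr
      R : Weighting
      R e = δ (proj₁ ru) x e + δ (proj₁ uw) x′ e
      x+x′≡t : x + x′ ≡ t
      x+x′≡t with side r
      ... | true  = refl
      ... | false = refl
      sumAt-R : ∀ z → sumAt R z ≈ δ r x z + δ w x′ z
      sumAt-R z = begin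
        sumAt R z                                         ≈⟨ sumAt-+ (δ (proj₁ ru) x) (δ (proj₁ uw) x′) z ⟩
        sumAt (δ (proj₁ ru) x) z + sumAt (δ (proj₁ uw) x′) z ≈⟨ +-cong (sumAt-adj ru x z) (sumAt-adj uw x′ z) ⟩
        (δ r x z + δ u x z) + (δ u x′ z + δ w x′ z)       ≡⟨ +-assoc (δ r x z) _ _ ⟩
        δ r x z + (δ u x z + (δ u x′ z + δ w x′ z))       ≡⟨ cong (δ r x z +_) (+-assoc (δ u x z) _ _) ⟨
        δ r x z + ((δ u x z + δ u x′ z) + δ w x′ z)       ≡⟨ cong (λ a → δ r x z + (a + δ w x′ z)) (δ-+ u z x x′) ⟩
        δ r x z + (δ u (x + x′) z + δ w x′ z)             ≈⟨ +-cong (≈-refl {δ r x z}) (+-cong u-unchanged ≈-refl) ⟩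
        δ r x z + (0 + δ w x′ z)                          ≡⟨⟩
        δ r x z + δ w x′ z                                ∎
        where
          u-unchanged : δ u (x + x′) z ≈ 0
          u-unchanged = ≈-trans (δ-cong u z (≈-trans (≡⇒≈ x+x′≡t) t≈0)) (≡⇒≈ (δ-0 u z))
      τ̄+x≡2 : τ̄ r + x ≡ 2
      τ̄+x≡2 with side r
      ... | true  = refl
      ... | false = refl
      τ+x′≡t-1 : τ r + x′ ≡ 2 + k
      τ+x′≡t-1 with side r
      ... | true  = refl
      ... | false = refl
      val-r : val R r ≈ 2
      val-r = begin
        sumAt W₀ r + sumAt R r             ≈⟨ +-cong conflict (sumAt-R r) ⟩
        τ̄ r + (δ r x r + δ w x′ r)         ≡⟨ cong₂ (λ a b → τ̄ r + (a + b)) (δ-diag r x) (δ-≢ x′ w≢r) ⟩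
        τ̄ r + (x + 0)                      ≡⟨ cong (τ̄ r +_) (+-identityʳ x) ⟩
        τ̄ r + x                            ≡⟨ τ̄+x≡2 ⟩
        2                                  ∎
      val-w : val R w ≈ 2 + k
      val-w = begin
        sumAt W₀ w + sumAt R w             ≈⟨ +-cong (W₀-settled root (within₂⇒₅ rw) w≢r) (sumAt-R w) ⟩
        τ w + (δ r x w + δ w x′ w)         ≡⟨ cong₂ (λ a b → a + (b + δ w x′ w)) τw≡τr (δ-≢ x (≢-sym w≢r)) ⟩
        τ r + (0 + δ w x′ w)               ≡⟨ cong (τ r +_) (δ-diag w x′) ⟩
        τ r + x′                           ≡⟨ τ+x′≡t-1 ⟩
        2 + k                              ∎

  raise-at-leaves : ∀ {r u₁ u₂} → Root 5 r → sumAt W₀ r ≈ τ̄ r → ¬ Path₂ r →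
    Adj G r u₁ → Adj G r u₂ → u₁ ≢ u₂ → Σ Weighting (Repair r)
  raise-at-leaves {r} {u₁} {u₂} root conflict ¬path ru₁ ru₂ u₁≢u₂ = R , patch root R (r ∷ leaves) (here refl)
    (λ { (here refl) → walk-refl 2 r ; (there l) → leaf-near l })
    outside-zero
    (λ { _ (here refl) _ → ≉-respˡ val-r (c+d≉c (τ̄ r) (s≤s z≤n) (≤2⇒<t ≤-refl))
       ; a (there l) q∉S → contradiction (_ , _ , leaf-adj l , a , λ { refl → q∉S (here refl) }) ¬path })
    (λ { a (here refl) (here refl) → contradiction refl (adj⇒≢ a)
       ; a (here refl) (there l)   → centre≉leaf l
       ; a (there l)   (here refl) → ≉-sym (centre≉leaf l)
       ; a (there l)   (there l′)  → contradiction (adj²⇒side≡ (adj-sym (leaf-adj l)) (leaf-adj l′))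
                                                    (adj⇒side≢ a) })
    where
      leaves : List V
      leaves = u₁ ∷ u₂ ∷ []
      leaf-adj : ∀ {z} → z ∈ leaves → Adj G r z
      leaf-adj (here refl)         = ru₁
      leaf-adj (there (here refl)) = ru₂
      leaf-near : ∀ {z} → z ∈ leaves → Walk≤ 2 r z
      leaf-near l = walk-mono (s≤s z≤n) (walk-adj (leaf-adj l))
      R : Weighting
      R e = δ (proj₁ ru₁) 1 e + δ (proj₁ ru₂) 1 e
      sumAt-R : ∀ z → sumAt R z ≈ (δ r 1 z + δ u₁ 1 z) + (δ r 1 z + δ u₂ 1 z)
      sumAt-R z = ≈-trans (sumAt-+ (δ (proj₁ ru₁) 1) (δ (proj₁ ru₂) 1) z)
                          (+-cong (sumAt-adj ru₁ 1 z) (sumAt-adj ru₂ 1 z))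
      outside-zero : ∀ z → z ∉ r ∷ leaves → sumAt R z ≈ 0
      outside-zero z z∉S = ≈-trans (sumAt-R z) (≡⇒≈ (cong₂ _+_
        (cong₂ _+_ (δ-≢ 1 r≢z) (δ-≢ 1 λ { refl → z∉S (there (here refl)) }))
        (cong₂ _+_ (δ-≢ 1 r≢z) (δ-≢ 1 λ { refl → z∉S (there (there (here refl))) }))))
        where
          r≢z : r ≢ z
          r≢z refl = z∉S (here refl)
      r∉leaves : ∀ {z} → z ∈ leaves → r ≢ z
      r∉leaves l = adj⇒≢ (leaf-adj l)
      val-r : val R r ≈ τ̄ r + 2
      val-r = +-cong conflict (≈-trans (sumAt-R r) (≡⇒≈ (cong₂ _+_
        (cong₂ _+_ (δ-diag r 1) (δ-≢ 1 (≢-sym (r∉leaves (here refl)))))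
        (cong₂ _+_ (δ-diag r 1) (δ-≢ 1 (≢-sym (r∉leaves (there (here refl)))))))))
      sumAt-R-leaf : ∀ {z} → z ∈ leaves → sumAt R z ≈ 1
      sumAt-R-leaf l@(here refl) = ≈-trans (sumAt-R u₁) (≡⇒≈ (cong₂ _+_
        (cong₂ _+_ (δ-≢ 1 (r∉leaves l)) (δ-diag u₁ 1))
        (cong₂ _+_ (δ-≢ 1 (r∉leaves l)) (δ-≢ 1 (≢-sym u₁≢u₂)))))
      sumAt-R-leaf l@(there (here refl)) = ≈-trans (sumAt-R u₂) (≡⇒≈ (cong₂ _+_
        (cong₂ _+_ (δ-≢ 1 (r∉leaves l)) (δ-≢ 1 u₁≢u₂))
        (cong₂ _+_ (δ-≢ 1 (r∉leaves l)) (δ-diag u₂ 1))))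
      val-leaf : ∀ {z} → z ∈ leaves → val R z ≈ τ̄ r + 1
      val-leaf l = +-cong (≈-trans (W₀-settled root (within₂⇒₅ (leaf-near l)) (≢-sym (r∉leaves l)))
                                   (≡⇒≈ (τ-adj (adj-sym (leaf-adj l)))))
                          (sumAt-R-leaf l)
      centre≉leaf : ∀ {z} → z ∈ leaves → val R r ≉ val R z
      centre≉leaf l = ≉-respʳ (≈-sym (val-leaf l)) (≉-respˡ (≈-trans val-r (≡⇒≈ (sym (+-assoc (τ̄ r) 1 1))))
        (c+d≉c (τ̄ r + 1) (s≤s z≤n) (≤2⇒<t (s≤s z≤n))))

  repair : ∀ r → Root 5 r → Σ Weighting (Repair r)
  repair r root with sumAt W₀ r ≈? τ̄ r
  ... | no  fine = (λ _ → 0) , no-conflict root λ _ → fine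
  ... | yes conflict with path₂? r | twoNeighbours? r
  ...   | yes (u , w , ru , uw , w≢r) | _ = raise-along-path₂ root conflict ru uw w≢r
  ...   | no ¬path | yes (u₁ , u₂ , ru₁ , ru₂ , u₁≢u₂) =
    raise-at-leaves root conflict ¬path ru₁ ru₂ u₁≢u₂
  ...   | no ¬path | no ¬two =
    (λ _ → 0) , no-conflict root λ ru → contradiction (isolated-edge⇒K₂ ru ¬path ¬two) nice

  repairAt : V → Weighting
  repairAt r with later? 5 r
  ... | yes _    = λ _ → 0
  ... | no  root = proj₁ (repair r root)

  repairAt-root : ∀ {r} → Root 5 r → Repair r (repairAt r)
  repairAt-root {r} root with later? 5 r
  ... | yes later = contradiction later root
  ... | no  root′ = proj₂ (repair r root′)

  repairAt-vanishes : ∀ r z → (Root 5 r → ¬ Walk≤ 2 r z) → sumAt (repairAt r) z ≈ 0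
  repairAt-vanishes r z far with later? 5 r
  ... | yes _    = sumAt-0 z
  ... | no  root = proj₁ (proj₂ (repair r root)) z (far root)

  final : Weighting
  final e = W₀ e + sum λ r → repairAt r e

  sumAt-final : ∀ z → sumAt final z ≈ sumAt W₀ z + sum (λ r → sumAt (repairAt r) z)
  sumAt-final z = ≈-trans (sumAt-+ W₀ _ z) (+-cong (≈-refl {sumAt W₀ z}) (sumAt-sum repairAt z))

  final-near : ∀ {r z} → Root 5 r → Walk≤ 3 r z → sumAt final z ≈ val (repairAt r) z
  final-near {r} {z} root rz = ≈-trans (sumAt-final z) (+-cong (≈-refl {sumAt W₀ z})
    (sum-select _ r λ r′ r′≢r → repairAt-vanishes r′ z λ root′ r′z →
      r′≢r (sym (root-unique root root′ (walk-++ rz (walk-sym r′z))))))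

  final-far : ∀ {z} → (∀ r → Root 5 r → ¬ Walk≤ 2 r z) → sumAt final z ≈ τ z
  final-far {z} far with later? 5 z
  ... | no  root  = contradiction (walk-refl 2 z) (far z root)
  ... | yes later = begin
    sumAt final z                                          ≈⟨ sumAt-final z ⟩
    sumAt W₀ z + sum (λ r → sumAt (repairAt r) z)          ≈⟨ +-cong (proj₂ (settle 5 τ) z later)
                                                                (sum-zero _ λ r → repairAt-vanishes r z (far r)) ⟩
    τ z + 0                                                ≡⟨ +-identityʳ (τ z) ⟩
    τ z                                                    ∎

  NearRoot : V → Set
  NearRoot z = Σ V λ r → Root 5 r × Walk≤ 2 r z

  nearRoot? : ∀ z → Dec (NearRoot z)
  nearRoot? z = any? λ r → ¬? (later? 5 r) ×-dec walk? 2 r z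

  final-proper-near : ∀ {p q} → Adj G p q → NearRoot p → sumAt final p ≉ sumAt final q
  final-proper-near {p} {q} a (r , root , rp) =
    ≉-respˡ (final-near root (walk-mono (s≤s (s≤s z≤n)) rp))
      (≉-respʳ (≈-sym (final-near root (walk-snoc rp a))) (proj₂ (repairAt-root root) p q a rp))

  final-proper : ∀ p q → Adj G p q → sumAt final p ≉ sumAt final q
  final-proper p q a with nearRoot? p | nearRoot? q
  ... | yes near | _        = final-proper-near a near
  ... | no  _    | yes near = ≉-sym (final-proper-near (adj-sym a) near)
  ... | no  ¬p   | no  ¬q   = ≉-respˡ (final-far λ r root rp → ¬p (r , root , rp))
      (≉-respʳ (≈-sym (final-far λ r root rq → ¬q (r , root , rq))) (adj⇒τ≉ a))

  colouring : Edge G → Fin t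
  colouring e = fromℕ< (m%n<n (final e) t)

  colouring-induces-final : ∀ z → inducedColour G t colouring z ≡ sumAt final z % t
  colouring-induces-final z = trans (inducedColour≡sumAt colouring z)
    (≈⇒%≡ (sumAt-cong (λ e → ≈-trans (≡⇒≈ (toℕ-fromℕ< _)) (%≡⇒≈ (m%n%n≡m%n (final e) t))) z))

  colouring-twin : IsImproperTwinColouring G t colouring
  colouring-twin u v a eq = final-proper u v a
    (%≡⇒≈ (trans (sym (colouring-induces-final u)) (trans eq (colouring-induces-final v))))

theorem2 : (G : Graph) → Nice G → Bipartite G →
    (t : ℕ) → (3≤t : 3 ≤ t) →
    HasImproperTwinColouring G t {{>-nonZero (<-≤-trans (s≤s z≤n) 3≤t)}}
theorem2 G nice (side , bipartite) (suc (suc (suc k))) (s≤s (s≤s (s≤s z≤n))) =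
  colouring , colouring-twin
  where open Construction G nice side bipartite k
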